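{- Let $G$ be a finite simple graph and $k$ a positive integer. If $D_{k+1}(G)$ is connected, then $X_k(G)$ is connected.
   Context: A set $S \subseteq V(G)$ is a dominating set of $G$ if every vertex of $V(G)\setminus S$ is adjacent to a vertex of $S$. For an integer $k$ at least the minimum cardinality of a dominating set of $G$, the $k$-dominating graph $D_k(G)$ is the graph whose vertices are the dominating sets of $G$ of cardinality at most $k$, two such sets $A,B$ being adjacent if and only if their symmetric difference $(A\setminus B)\cup(B\setminus A)$ consists of exactly one vertex of $G$. $X_k(G)$ is the graph whose vertices are the dominating sets of $G$ of cardinality exactly $k$, with two such sets $S,T$ adjacent if there exist $s \in S$ and $t \in T$ with $T = (S\setminus\{s\})\cup\{t\}$ (and $S \neq T$). -}

module Defs where


open import Data.Nat using (ℕ; suc; _≤_)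
open import Data.Fin using (Fin)
open import Data.Fin.Subset using (Subset; _∈_; _∉_; _∪_; _─_; ⁅_⁆; ∣_∣)
open import Data.Product using (Σ; ∃; _×_; _,_)
open import Data.Sum using (_⊎_)
open import Relation.Nullary using (¬_)
open import Relation.Binary.PropositionalEquality using (_≡_; _≢_)

record Graph (n : ℕ) : Set₁ where
  field
    Adj     : Fin n → Fin n → Set
    sym     : ∀ {u v} → Adj u v → Adj v u
    irrefl  : ∀ {v} → ¬ Adj v v
open Graph public

Dominating : ∀ {n} → Graph n → Subset n → Set
Dominating {n} G S = ∀ (v : Fin n) → v ∉ S → ∃ λ u → u ∈ S × Adj G v u

-- An (abstract) graph whose vertices are the elements of a type A
-- satisfying a predicate V, with edge relation E.
data Walk {A : Set} (V : A → Set) (E : A → A → Set) : A → A → Set where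
  here : ∀ {a} → Walk V E a a
  step : ∀ {a b c} → V b → E a b → Walk V E b c → Walk V E a c

Connected : {A : Set} (V : A → Set) (E : A → A → Set) → Set
Connected V E = ∀ {a b} → V a → V b → Walk V E a b

_△_ : ∀ {n} → Subset n → Subset n → Subset n
A △ B = (A ─ B) ∪ (B ─ A)

DkVertex : ∀ {n} → Graph n → ℕ → Subset n → Set
DkVertex G k S = Dominating G S × ∣ S ∣ ≤ k

DkEdge : ∀ {n} → Subset n → Subset n → Set
DkEdge A B = ∣ A △ B ∣ ≡ 1

DkConnected : ∀ {n} → Graph n → ℕ → Set
DkConnected G k = Connected (DkVertex G k) DkEdge

XkVertex : ∀ {n} → Graph n → ℕ → Subset n → Set
XkVertex G k S = Dominating G S × ∣ S ∣ ≡ k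

XkEdge : ∀ {n} → Subset n → Subset n → Set
XkEdge {n} S T =
  Σ (Fin n) λ s → Σ (Fin n) λ t →
    s ∈ S × t ∈ T × T ≡ (S ─ ⁅ s ⁆) ∪ ⁅ t ⁆ × S ≢ T

XkConnected : ∀ {n} → Graph n → ℕ → Set
XkConnected G k = Connected (XkVertex G k) XkEdge

module Submission where

-- Let S, T be dominating sets of size k.  Both are vertices of
-- D_{k+1}(G), so there is a walk S = a₀, a₁, …, aₘ = T in D_{k+1}(G); each
-- step adds or removes one vertex.  We walk along it while maintaining a
-- k-element dominating set X, reachable from S in X_k(G), that is
-- comparable (⊆ or ⊇) with the current aᵢ.  When aᵢ₊₁ = aᵢ ∪ {x} and X
-- no longer fits, then aᵢ ⊆ X, x ∉ X and some z ∈ X is outside aᵢ; the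
-- exchange X - z + x contains aᵢ₊₁, hence dominates.  When aᵢ₊₁ = aᵢ - x
-- and X no longer fits, then X ⊆ aᵢ, x ∈ X and some w ∈ aᵢ₊₁ is outside
-- X; the exchange X - x + w lies inside aᵢ₊₁ and has size k ≥ ∣aᵢ₊₁∣, so
-- it equals aᵢ₊₁ and dominates.  At the end X is comparable with T and has
-- the same size, so X = T.

open import Defs hiding (sym)
open import Data.Nat using (ℕ; suc; _≤_)
open import Data.Nat.Properties using (suc-injective; <⇒≱; ≤-pred; ≤-reflexive; n≤1+n)
open import Data.Fin using (Fin; zero; suc)
open import Data.Fin.Properties using (¬∀⟶∃¬)
open import Data.Fin.Subset
open import Data.Fin.Subset.Properties
open import Data.Vec.Base using ([]; _∷_) renaming (here to here∈; there to there∈)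
open import Data.Product using (∃; _×_; _,_; proj₁; proj₂)
open import Data.Sum using (_⊎_; inj₁; inj₂)
open import Data.Empty using (⊥-elim)
open import Function using (_∘_)
open import Relation.Nullary using (¬_; yes; no)
open import Relation.Nullary.Decidable using (_→-dec_; decidable-stable)
open import Relation.Binary.PropositionalEquality

_◅◅_ : ∀ {A : Set} {V : A → Set} {E : A → A → Set} {a b c : A} →
  Walk V E a b → Walk V E b c → Walk V E a c
here       ◅◅ w′ = w′
step v e w ◅◅ w′ = step v e (w ◅◅ w′)

⊈-witness : ∀ {n} {p q : Subset n} → ¬ p ⊆ q → ∃ λ z → z ∈ p × z ∉ q
⊈-witness {n} {p} {q} p⊈q with ¬∀⟶∃¬ n (λ z → z ∈ p → z ∈ q)
                                       (λ z → z ∈? p →-dec z ∈? q) (λ h → p⊈q (h _))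
... | z , ¬[z∈p⇒z∈q] =
  z , decidable-stable (z ∈? p) (λ z∉p → ¬[z∈p⇒z∈q] (⊥-elim ∘ z∉p)) ,
      (λ z∈q → ¬[z∈p⇒z∈q] (λ _ → z∈q))

⊆-size-antisym : ∀ {n} {p q : Subset n} → p ⊆ q → ∣ q ∣ ≤ ∣ p ∣ → p ≡ q
⊆-size-antisym {p = p} {q} p⊆q ∣q∣≤∣p∣ with q ⊆? p
... | yes q⊆p = ⊆-antisym p⊆q q⊆p
... | no q⊈p with ⊈-witness q⊈p
...   | z , z∈q , z∉p = ⊥-elim (<⇒≱ (p⊂q⇒∣p∣<∣q∣ (p⊆q , z , z∈q , z∉p)) ∣q∣≤∣p∣)

Comparable : ∀ {n} → Subset n → Subset n → Set
Comparable p q = p ⊆ q ⊎ q ⊆ p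

comparable-same-size : ∀ {n} {p q : Subset n} → Comparable p q → ∣ p ∣ ≡ ∣ q ∣ → p ≡ q
comparable-same-size (inj₁ p⊆q) ∣p∣≡∣q∣ = ⊆-size-antisym p⊆q (≤-reflexive (sym ∣p∣≡∣q∣))
comparable-same-size (inj₂ q⊆p) ∣p∣≡∣q∣ = sym (⊆-size-antisym q⊆p (≤-reflexive ∣p∣≡∣q∣))

x∈p─q⇒x∉q : ∀ {n} (p q : Subset n) {x} → x ∈ p ─ q → x ∉ q
x∈p─q⇒x∉q (_ ∷ p) (_ ∷ q) (there∈ x∈p─q) (there∈ x∈q) = x∈p─q⇒x∉q p q x∈p─q x∈q

∣p-x∣ : ∀ {n} (p : Subset n) {x} → x ∈ p → suc ∣ p - x ∣ ≡ ∣ p ∣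
∣p-x∣ (inside  ∷ p) here∈        = cong (suc ∘ ∣_∣) (p─⊥≡p p)
∣p-x∣ (inside  ∷ p) (there∈ x∈p) = cong suc (∣p-x∣ p x∈p)
∣p-x∣ (outside ∷ p) (there∈ x∈p) = ∣p-x∣ p x∈p

∣p∪⁅x⁆∣ : ∀ {n} (p : Subset n) {x} → x ∉ p → ∣ p ∪ ⁅ x ⁆ ∣ ≡ suc ∣ p ∣
∣p∪⁅x⁆∣ (inside  ∷ p) {zero}  x∉p = ⊥-elim (x∉p here∈)
∣p∪⁅x⁆∣ (outside ∷ p) {zero}  x∉p = cong (suc ∘ ∣_∣) (∪-identityʳ p)
∣p∪⁅x⁆∣ (inside  ∷ p) {suc x} x∉p = cong suc (∣p∪⁅x⁆∣ p (x∉p ∘ there∈))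
∣p∪⁅x⁆∣ (outside ∷ p) {suc x} x∉p = ∣p∪⁅x⁆∣ p (x∉p ∘ there∈)

△-empty : ∀ {n} (a b : Subset n) → ∣ a △ b ∣ ≡ 0 → a ≡ b
△-empty []            []            _  = refl
△-empty (inside  ∷ a) (inside  ∷ b) eq = cong (inside  ∷_) (△-empty a b eq)
△-empty (outside ∷ a) (outside ∷ b) eq = cong (outside ∷_) (△-empty a b eq)
△-empty (inside  ∷ a) (outside ∷ b) ()
△-empty (outside ∷ a) (inside  ∷ b) ()

OneVertexApart : ∀ {n} → Subset n → Subset n → Set
OneVertexApart a b = ∃ λ x → b ≡ a ∪ ⁅ x ⁆ ⊎ (x ∈ a × b ≡ a - x)

∷-apart : ∀ {n} s {a b : Subset n} → OneVertexApart a b → OneVertexApart (s ∷ a) (s ∷ b)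
∷-apart inside  (x , inj₁ eq)         = suc x , inj₁ (cong (inside ∷_) eq)
∷-apart outside (x , inj₁ eq)         = suc x , inj₁ (cong (outside ∷_) eq)
∷-apart inside  (x , inj₂ (x∈a , eq)) = suc x , inj₂ (there∈ x∈a , cong (inside ∷_) eq)
∷-apart outside (x , inj₂ (x∈a , eq)) = suc x , inj₂ (there∈ x∈a , cong (outside ∷_) eq)

△-singleton : ∀ {n} (a b : Subset n) → ∣ a △ b ∣ ≡ 1 → OneVertexApart a b
△-singleton []            []            ()
△-singleton (inside  ∷ a) (inside  ∷ b) eq = ∷-apart inside  (△-singleton a b eq)
△-singleton (outside ∷ a) (outside ∷ b) eq = ∷-apart outside (△-singleton a b eq)
△-singleton (outside ∷ a) (inside  ∷ b) eq = zero , inj₁ (cong (inside ∷_) b≡a∪⊥)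
  where
  b≡a∪⊥ : b ≡ a ∪ ⊥
  b≡a∪⊥ = trans (sym (△-empty a b (suc-injective eq))) (sym (∪-identityʳ a))
△-singleton (inside  ∷ a) (outside ∷ b) eq = zero , inj₂ (here∈ , cong (outside ∷_) b≡a─⊥)
  where
  b≡a─⊥ : b ≡ a ─ ⊥
  b≡a─⊥ = trans (sym (△-empty a b (suc-injective eq))) (sym (p─⊥≡p a))

swap : ∀ {n} → Subset n → Fin n → Fin n → Subset n
swap X z t = (X - z) ∪ ⁅ t ⁆

∈-swap⁺ : ∀ {n} {X : Subset n} {z t y} → (y ∈ X × y ≢ z) ⊎ y ≡ t → y ∈ swap X z t
∈-swap⁺ (inj₁ (y∈X , y≢z)) = x∈p∪q⁺ (inj₁ (x∈p∧x≢y⇒x∈p-y y∈X y≢z))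
∈-swap⁺ {t = t} (inj₂ refl) = x∈p∪q⁺ (inj₂ (x∈⁅x⁆ t))

∈-swap⁻ : ∀ {n} {X : Subset n} {z t y} → y ∈ swap X z t → (y ∈ X × y ≢ z) ⊎ y ≡ t
∈-swap⁻ {X = X} {z} {t} y∈swap with x∈p∪q⁻ (X - z) ⁅ t ⁆ y∈swap
... | inj₁ y∈X-z = inj₁ (p─q⊆p X ⁅ z ⁆ y∈X-z , x∉⁅y⁆⇒x≢y (x∈p─q⇒x∉q X ⁅ z ⁆ y∈X-z))
... | inj₂ y∈⁅t⁆ = inj₂ (x∈⁅y⁆⇒x≡y t y∈⁅t⁆)

∣swap∣ : ∀ {n} {X : Subset n} {z t} → z ∈ X → t ∉ X → ∣ swap X z t ∣ ≡ ∣ X ∣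
∣swap∣ {X = X} {z} {t} z∈X t∉X =
  trans (∣p∪⁅x⁆∣ (X - z) (t∉X ∘ p─q⊆p X ⁅ z ⁆)) (∣p-x∣ X z∈X)

swap-edge : ∀ {n} {X : Subset n} {z t} → z ∈ X → t ∉ X → XkEdge X (swap X z t)
swap-edge {z = z} {t} z∈X t∉X =
  z , t , z∈X , t∈swap , refl , λ X≡swap → t∉X (subst (t ∈_) (sym X≡swap) t∈swap)
  where
  t∈swap = ∈-swap⁺ (inj₂ refl)

dominating-⊆ : ∀ {n} (G : Graph n) {a b : Subset n} → Dominating G a → a ⊆ b → Dominating G b
dominating-⊆ G {a} d a⊆b v v∉b with v ∈? a
... | yes v∈a = ⊥-elim (v∉b (a⊆b v∈a))
... | no v∉a with d v v∉a
...   | u , u∈a , v~u = u , a⊆b u∈a , v~u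

module Tracking {n : ℕ} (G : Graph n) (k : ℕ) where

  DVertex XVertex : Subset n → Set
  DVertex = DkVertex G (suc k)
  XVertex = XkVertex G k

  XWalk : Subset n → Subset n → Set
  XWalk = Walk XVertex XkEdge

  X⇒D : ∀ {X} → XVertex X → DVertex X
  X⇒D {X} (dom , ∣X∣≡k) = dom , subst (_≤ suc k) (sym ∣X∣≡k) (n≤1+n k)

  _↝_ : Subset n → Subset n → Set
  X ↝ a = ∃ λ Y → XWalk X Y × XVertex Y × Comparable Y a

  stay : ∀ {X a} → XVertex X → Comparable X a → X ↝ a
  stay {X} xX cmp = X , here , xX , cmp

  exchange : ∀ {X a z t} → XVertex X → z ∈ X → t ∉ X →
    Dominating G (swap X z t) → Comparable (swap X z t) a → X ↝ a
  exchange {X} {z = z} {t} (_ , ∣X∣≡k) z∈X t∉X dom cmp =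
    swap X z t , step xY (swap-edge z∈X t∉X) here , xY , cmp
    where
    xY : XVertex (swap X z t)
    xY = dom , trans (∣swap∣ z∈X t∉X) ∣X∣≡k

  -- Following an edge a → a ∪ {x}: if X no longer fits, exchange some
  -- z ∈ X ∖ a for x; the result contains a ∪ {x}, hence dominates.
  follow-add : ∀ {a X x} → DVertex (a ∪ ⁅ x ⁆) →
    XVertex X → Comparable X a → X ↝ (a ∪ ⁅ x ⁆)
  follow-add {x = x} _ xX (inj₁ X⊆a) = stay xX (inj₁ (p⊆p∪q ⁅ x ⁆ ∘ X⊆a))
  follow-add {a} {X} {x} da′ xX (inj₂ a⊆X) with x ∈? X | X ⊆? a
  ... | yes x∈X | _      = stay xX (inj₂ a′⊆X)
    where
    a′⊆X : a ∪ ⁅ x ⁆ ⊆ X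
    a′⊆X y∈a′ with x∈p∪q⁻ a ⁅ x ⁆ y∈a′
    ... | inj₁ y∈a = a⊆X y∈a
    ... | inj₂ y∈⁅x⁆ = subst (_∈ X) (sym (x∈⁅y⁆⇒x≡y x y∈⁅x⁆)) x∈X
  ... | no _    | yes X⊆a = stay xX (inj₁ (p⊆p∪q ⁅ x ⁆ ∘ X⊆a))
  ... | no x∉X  | no X⊈a with ⊈-witness X⊈a
  ...   | z , z∈X , z∉a = exchange xX z∈X x∉X (dominating-⊆ G (proj₁ da′) a′⊆Y) (inj₂ a′⊆Y)
    where
    a′⊆Y : a ∪ ⁅ x ⁆ ⊆ swap X z x
    a′⊆Y y∈a′ with x∈p∪q⁻ a ⁅ x ⁆ y∈a′
    ... | inj₁ y∈a = ∈-swap⁺ (inj₁ (a⊆X y∈a , λ { refl → z∉a y∈a }))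
    ... | inj₂ y∈⁅x⁆ = ∈-swap⁺ (inj₂ (x∈⁅y⁆⇒x≡y x y∈⁅x⁆))

  -- Following an edge a → a - x: if X no longer fits, exchange x for some
  -- w ∈ (a - x) ∖ X; the result lies in a - x and has size k ≥ ∣a - x∣,
  -- so it is a - x itself and dominates.
  follow-remove : ∀ {a X x} → DVertex a → DVertex (a - x) → x ∈ a →
    XVertex X → Comparable X a → X ↝ (a - x)
  follow-remove {a} {x = x} _ _ _ xX (inj₂ a⊆X) = stay xX (inj₂ (a⊆X ∘ p─q⊆p a ⁅ x ⁆))
  follow-remove {a} {X} {x} da da′ x∈a xX (inj₁ X⊆a) with x ∈? X | a - x ⊆? X
  ... | no x∉X  | _       = stay xX (inj₁ X⊆a′)
    where
    X⊆a′ : X ⊆ a - x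
    X⊆a′ y∈X = x∈p∧x≢y⇒x∈p-y (X⊆a y∈X) (λ { refl → x∉X y∈X })
  ... | yes _   | yes a′⊆X = stay xX (inj₂ a′⊆X)
  ... | yes x∈X | no a′⊈X with ⊈-witness a′⊈X
  ...   | w , w∈a′ , w∉X = exchange xX x∈X w∉X (subst (Dominating G) (sym Y≡a′) (proj₁ da′)) (inj₁ Y⊆a′)
    where
    Y⊆a′ : swap X x w ⊆ a - x
    Y⊆a′ y∈Y with ∈-swap⁻ y∈Y
    ... | inj₁ (y∈X , y≢x) = x∈p∧x≢y⇒x∈p-y (X⊆a y∈X) y≢x
    ... | inj₂ refl = w∈a′
    ∣a′∣≤∣Y∣ : ∣ a - x ∣ ≤ ∣ swap X x w ∣
    ∣a′∣≤∣Y∣ = subst (∣ a - x ∣ ≤_) (sym (trans (∣swap∣ x∈X w∉X) (proj₂ xX)))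
                 (≤-pred (subst (_≤ suc k) (sym (∣p-x∣ a x∈a)) (proj₂ da)))
    Y≡a′ : swap X x w ≡ a - x
    Y≡a′ = ⊆-size-antisym Y⊆a′ ∣a′∣≤∣Y∣

  follow-edge : ∀ {a b X} → DVertex a → DVertex b → DkEdge a b →
    XVertex X → Comparable X a → X ↝ b
  follow-edge {a} {b} da db e xX cmp with △-singleton a b e
  ... | x , inj₁ refl         = follow-add db xX cmp
  ... | x , inj₂ (x∈a , refl) = follow-remove da db x∈a xX cmp

  -- Along a whole walk of D_{k+1} ending in an X_k-vertex b, the tracked
  -- set ends up comparable with b and of the same size, hence equal to b.
  follow-walk : ∀ {a b X} → Walk DVertex DkEdge a b → DVertex a → XVertex b →
    XVertex X → Comparable X a → XWalk X b
  follow-walk {X = X} here _ xb xX cmp =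
    subst (XWalk X) (comparable-same-size cmp (trans (proj₂ xX) (sym (proj₂ xb)))) here
  follow-walk (step db e w) da xb xX cmp with follow-edge da db e xX cmp
  ... | Y , X⇝Y , xY , cmpY = X⇝Y ◅◅ follow-walk w db xb xY cmpY

theorem12 : ∀ {n : ℕ} (G : Graph n) (k : ℕ) → 1 ≤ k →
    DkConnected G (suc k) → XkConnected G k
theorem12 G k _ D-connected xS xT =
  follow-walk (D-connected (X⇒D xS) (X⇒D xT)) (X⇒D xS) xT xS (inj₁ ⊆-refl)
  where
  open Tracking G k
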